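{- If $f\in F_n^{\nearrow}$ is the nom code of the permutation $\sigma\in\mathfrak{S}_n$ (i.e. $\phi(f)=\sigma$), then $\mathrm{Flip}(f)$ is the nom code of the permutation $\tau=((\sigma^{ -1})^{r})^{c}$.
   Context: $[n]=\{1,\dots,n\}$, $\mathfrak{S}_n$ the symmetric group on $[n]$; products of permutations are composed with the leftmost factor acting first: $(\alpha\beta)(x)=\beta(\alpha(x))$. A function $f:[n]\to[n]$ is subexceedant if $1\le f(i)\le i$ for all $i$, written $f_1\cdots f_n$; $F_n$ is the set of such functions and $F_n^{\nearrow}$ the non-decreasing ones. $\phi:F_n\to\mathfrak{S}_n$, $\phi(f)=(1,f_1)(2,f_2)\cdots(n,f_n)$ (with $(i,i)$ the identity), is a bijection; $\phi^{ -1}(\sigma)$ is the nom code of $\sigma$. For $f\in F_n^{\nearrow}$ with $r_k=|\{i:f_i=k\}|$, $\mathrm{Flip}(f)=f'_1\cdots f'_n$ with $f'_i=n+1-\sum_{k=1}^{n-i+1}r_k$. For $\pi\in\mathfrak{S}_n$, the reverse is $\pi^r(i)=\pi(n+1-i)$ and the complement is $\pi^c(i)=n+1-\pi(i)$. -}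

module Defs where

open import Data.Nat using (ℕ; zero; suc; _+_; _∸_; _≤_; _≟_)
open import Data.Fin using (Fin; toℕ; opposite)
open import Data.Fin.Permutation using (Permutation′; _⟨$⟩ˡ_)
open import Relation.Nullary.Decidable using (does)
open import Data.Bool using (if_then_else_)

-- Labels of [n] are the natural numbers 1..n (1-based, as in the paper).
-- A function f : [n] → [n] is represented as f : ℕ → ℕ; only f 1, …, f n matter.

Subexceedant : ℕ → (ℕ → ℕ) → Set
Subexceedant n f = ∀ i → 1 ≤ i → i ≤ n → (1 ≤ f i) × (f i ≤ i)
  where open import Data.Product using (_×_)

NonDecreasing : ℕ → (ℕ → ℕ) → Set
NonDecreasing n f = ∀ i j → 1 ≤ i → i ≤ j → j ≤ n → f i ≤ f j

InFnUp : ℕ → (ℕ → ℕ) → Set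
InFnUp n f = Subexceedant n f × NonDecreasing n f
  where open import Data.Product using (_×_)

swap : ℕ → ℕ → ℕ → ℕ
swap a b x = if does (x ≟ a) then b else (if does (x ≟ b) then a else x)

-- (1,f 1)(2,f 2)⋯(m,f m), leftmost factor acting first
phiUpTo : (ℕ → ℕ) → ℕ → ℕ → ℕ
phiUpTo f zero    x = x
phiUpTo f (suc m) x = swap (suc m) (f (suc m)) (phiUpTo f m x)

phi : ℕ → (ℕ → ℕ) → ℕ → ℕ
phi n f = phiUpTo f n

countUpTo : (ℕ → ℕ) → ℕ → ℕ → ℕ
countUpTo f k zero    = 0
countUpTo f k (suc m) = (if does (f (suc m) ≟ k) then 1 else 0) + countUpTo f k m

r : ℕ → (ℕ → ℕ) → ℕ → ℕ
r n f k = countUpTo f k n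

sumR : ℕ → (ℕ → ℕ) → ℕ → ℕ
sumR n f zero    = 0
sumR n f (suc m) = r n f (suc m) + sumR n f m

Flip : ℕ → (ℕ → ℕ) → ℕ → ℕ
Flip n f i = (n + 1) ∸ sumR n f ((n ∸ i) + 1)

-- σ ∈ 𝔖_n (Fin n, 0-based) corresponds to the label map
-- i ↦ toℕ (σ (i-1)) + 1; "φ(f) = σ" means agreement on [n].
RepresentedBy : ∀ {n} → (ℕ → ℕ) → (Fin n → Fin n) → Set
RepresentedBy g σ = ∀ x → g (suc (toℕ x)) ≡ suc (toℕ (σ x))
  where open import Relation.Binary.PropositionalEquality using (_≡_)

-- τ = ((σ⁻¹)^r)^c : i ↦ n+1 − σ⁻¹(n+1−i); in 0-based Fin this is
-- opposite ∘ σ⁻¹ ∘ opposite.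
tau : ∀ {n} → Permutation′ n → Fin n → Fin n
tau σ x = opposite (σ ⟨$⟩ˡ opposite x)

-- Write ω for x ↦ n + 1 − x. For f ∈ F_n^↗ the code h = ω ∘ f ∘ ω is superexceedant
-- (j ≤ h j ≤ n) and non-decreasing, and since ω conjugates (k, f k) into (ω k, h (ω k)),
-- φ(h) = ω φ(f)⁻¹ ω. Counting the r_k backwards shows Flip(f)_i = 1 + #{ j ∈ [n] ∣ h j < i }.
-- The heart of the proof is that this subexceedant code has the same product as h, for every
-- superexceedant non-decreasing h. By induction on n: h(n+1) = n+1, and h equals n+1 exactly on
-- some interval (m, n+1]; truncating h at n replaces the factors (j, n+1), m < j ≤ n, by (j, n),
-- and the cycle identity (m+1, n)⋯(n, n)(n+1, m+1) = (m+1, n+1)⋯(n, n+1) repairs this with the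
-- single factor (n+1, m+1), which is exactly the last factor of the subexceedant code.
-- Hence φ(Flip f) = ω σ⁻¹ ω = τ.
module Submission where

open import Data.Bool.Base using (if_then_else_)
open import Data.Fin.Base using (Fin; toℕ; opposite)
open import Data.Fin.Properties using (toℕ<n; opposite-prop; opposite-involutive)
open import Data.Fin.Permutation using (Permutation′; _⟨$⟩ʳ_; _⟨$⟩ˡ_; inverseʳ)
open import Data.Nat.Base
open import Data.Nat.Properties
open import Algebra.Properties.CommutativeSemigroup +-commutativeSemigroup using (interchange; x∙yz≈y∙xz)
open import Data.Product.Base using (_×_; _,_; proj₁; proj₂)
open import Data.Sum.Base using (inj₁; inj₂; [_,_]′)
open import Function.Base using (_∘_)
open import Function.Bundles using (_⇔_; mk⇔)
open import Function.Definitions using (Injective)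
open import Level using (Level)
open import Relation.Binary.PropositionalEquality
open import Relation.Nullary.Decidable using (Dec; does; yes; no; ¬?; dec-true; dec-false; does-⇔)
open import Relation.Nullary.Negation using (¬_; contradiction)
open import Relation.Unary using (Pred; Decidable)

open import Defs

open ≡-Reasoning

swap-left : ∀ a b → swap a b a ≡ b
swap-left a b rewrite dec-true (a ≟ a) refl = refl

swap-right : ∀ a b → swap a b b ≡ a
swap-right a b with b ≟ a
... | yes refl = swap-left b b
... | no b≢a rewrite dec-false (b ≟ a) b≢a | dec-true (b ≟ b) refl = refl

swap-other : ∀ {a b x} → x ≢ a → x ≢ b → swap a b x ≡ x
swap-other {a} {b} {x} x≢a x≢b rewrite dec-false (x ≟ a) x≢a | dec-false (x ≟ b) x≢b = refl

swap-diag : ∀ a x → swap a a x ≡ x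
swap-diag a x with x ≟ a
... | yes refl = swap-left x x
... | no x≢a = swap-other x≢a x≢a

swap-comm : ∀ a b x → swap a b x ≡ swap b a x
swap-comm a b x with x ≟ a | x ≟ b
... | yes refl | yes refl = refl
... | yes refl | no _ = trans (swap-left x b) (sym (swap-right b x))
... | no _ | yes refl = trans (swap-right a x) (sym (swap-left x a))
... | no x≢a | no x≢b = trans (swap-other x≢a x≢b) (sym (swap-other x≢b x≢a))

swap-involutive : ∀ a b x → swap a b (swap a b x) ≡ x
swap-involutive a b x with x ≟ a | x ≟ b
... | yes refl | _ = trans (cong (swap x b) (swap-left x b)) (swap-right x b)
... | no _ | yes refl = trans (cong (swap a x) (swap-right a x)) (swap-left a x)
... | no x≢a | no x≢b = trans (cong (swap a b) (swap-other x≢a x≢b)) (swap-other x≢a x≢b)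

swap-injective : ∀ a b → Injective _≡_ _≡_ (swap a b)
swap-injective a b {x} {y} eq = begin
  x                         ≡⟨ swap-involutive a b x ⟨
  swap a b (swap a b x)     ≡⟨ cong (swap a b) eq ⟩
  swap a b (swap a b y)     ≡⟨ swap-involutive a b y ⟩
  y                         ∎

swap-conjugate : ∀ (σ : ℕ → ℕ) → Injective _≡_ _≡_ σ →
                 ∀ a b x → σ (swap a b x) ≡ swap (σ a) (σ b) (σ x)
swap-conjugate σ σ-inj a b x with x ≟ a | x ≟ b
... | yes refl | _ = trans (cong σ (swap-left x b)) (sym (swap-left (σ x) (σ b)))
... | no _ | yes refl = trans (cong σ (swap-right a x)) (sym (swap-right (σ a) (σ x)))
... | no x≢a | no x≢b =
  trans (cong σ (swap-other x≢a x≢b)) (sym (swap-other (x≢a ∘ σ-inj) (x≢b ∘ σ-inj)))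

segment : ℕ → ℕ → ℕ → ℕ → ℕ
segment c m zero    z = z
segment c m (suc u) z = swap (suc (m + u)) c (segment c m u z)

segment-injective : ∀ c m u → Injective _≡_ _≡_ (segment c m u)
segment-injective c m zero    eq = eq
segment-injective c m (suc u) eq = segment-injective c m u (swap-injective _ c eq)

segment-fixes : ∀ {c m x} u → m + u < x → x ≢ c → segment c m u x ≡ x
segment-fixes zero _ _ = refl
segment-fixes {c} {m} {x} (suc u) m+1+u<x x≢c = begin
  swap (suc (m + u)) c (segment c m u x)
    ≡⟨ cong (swap _ c) (segment-fixes u (<-trans (n<1+n _) 1+m+u<x) x≢c) ⟩
  swap (suc (m + u)) c x
    ≡⟨ swap-other (>⇒≢ 1+m+u<x) x≢c ⟩
  x
    ∎
  where
  1+m+u<x = subst (_< x) (+-suc m u) m+1+u<x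

segment-sends-centre : ∀ {c m} u → m + u < c → segment c m (suc u) c ≡ suc m
segment-sends-centre {c} {m} zero _ = trans (swap-right _ c) (cong suc (+-identityʳ m))
segment-sends-centre {c} {m} (suc u) m+1+u<c = begin
  swap (suc (m + suc u)) c (segment c m (suc u) c)
    ≡⟨ cong (swap _ c) (segment-sends-centre u (<-trans (+-monoʳ-< m (n<1+n u)) m+1+u<c)) ⟩
  swap (suc (m + suc u)) c (suc m)
    ≡⟨ swap-other (<⇒≢ (s≤s m<m+1+u)) (<⇒≢ (≤-<-trans m<m+1+u m+1+u<c)) ⟩
  suc m
    ∎
  where
  m<m+1+u = m<m+n m z<s

segment-conjugate : ∀ {c d m} u → m + u < c → m + u < d →
                    ∀ z → segment d m u z ≡ swap c d (segment c m u (swap c d z))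
segment-conjugate zero _ _ z = sym (swap-involutive _ _ z)
segment-conjugate {c} {d} {m} (suc u) m+1+u<c m+1+u<d z = begin
  swap j d (segment d m u z)
    ≡⟨ cong (swap j d) (segment-conjugate u (<-trans (n<1+n _) j<c) (<-trans (n<1+n _) j<d) z) ⟩
  swap j d (swap c d w)
    ≡⟨ cong₂ (λ a b → swap a b (swap c d w)) (swap-other (<⇒≢ j<c) (<⇒≢ j<d)) (swap-left c d) ⟨
  swap (swap c d j) (swap c d c) (swap c d w)
    ≡⟨ swap-conjugate (swap c d) (swap-injective c d) j c w ⟨
  swap c d (swap j c w)
    ∎
  where
  j = suc (m + u)
  w = segment c m u (swap c d z)
  j<c = subst (_< c) (+-suc m u) m+1+u<c
  j<d = subst (_< d) (+-suc m u) m+1+u<d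

-- S = (m+1, c)⋯(m+u, c) sends c to m+1 and fixes d = c+1, so S conjugates (c, d) into (m+1, d).
segment-cycle : ∀ m t z →
  swap (suc (m + t)) (suc m) (segment (m + t) m t z) ≡ segment (suc (m + t)) m t z
segment-cycle m zero z rewrite +-identityʳ m = swap-diag (suc m) z
segment-cycle m (suc u) z rewrite +-suc m u = begin
  swap d (suc m) (swap c c (S z))        ≡⟨ cong (swap d (suc m)) (swap-diag c (S z)) ⟩
  swap d (suc m) (S z)                   ≡⟨ swap-comm d (suc m) (S z) ⟩
  swap (suc m) d (S z)                   ≡⟨ cong₂ (λ a b → swap a b (S z)) (S-centre u) S-d ⟨
  swap (S c) (S d) (S z)                 ≡⟨ swap-conjugate S (segment-injective c m u) c d z ⟨
  S (swap c d z)                         ≡⟨ swap-involutive c d _ ⟨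
  swap c d (swap c d (S (swap c d z)))   ≡⟨ cong (swap c d) (segment-conjugate u (n<1+n _) m+u<d z) ⟨
  swap c d (segment d m u z)             ∎
  where
  c = suc (m + u)
  d = suc c
  S = segment c m u
  S-centre : ∀ u → segment (suc (m + u)) m u (suc (m + u)) ≡ suc m
  S-centre zero    = cong suc (+-identityʳ m)
  S-centre (suc v) = segment-sends-centre v (s≤s (+-monoʳ-≤ m (n≤1+n v)))
  m+u<d = <-trans (n<1+n _) (n<1+n _)
  S-d : S d ≡ d
  S-d = segment-fixes u m+u<d (>⇒≢ (n<1+n c))

phiUpTo-cong : ∀ {g g'} m → (∀ j → 1 ≤ j → j ≤ m → g j ≡ g' j) →
               ∀ y → phiUpTo g m y ≡ phiUpTo g' m y
phiUpTo-cong zero    _     y = refl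
phiUpTo-cong (suc m) g≗g' y =
  cong₂ (swap (suc m)) (g≗g' (suc m) (s≤s z≤n) ≤-refl)
        (phiUpTo-cong m (λ j 1≤j j≤m → g≗g' j 1≤j (m≤n⇒m≤1+n j≤m)) y)

phiUpTo-constTail : ∀ {g c} m u → (∀ j → m < j → j ≤ m + u → g j ≡ c) →
                    ∀ y → phiUpTo g (m + u) y ≡ segment c m u (phiUpTo g m y)
phiUpTo-constTail m zero    _   y rewrite +-identityʳ m = refl
phiUpTo-constTail m (suc u) g≡c y rewrite +-suc m u =
  cong₂ (swap (suc (m + u))) (g≡c _ (s≤s (m≤m+n m u)) ≤-refl)
        (phiUpTo-constTail m u (λ j m<j j≤m+u → g≡c j m<j (m≤n⇒m≤1+n j≤m+u)) y)

phiUpTo-raiseTail : ∀ {g g' m n} → m ≤ n →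
  (∀ j → 1 ≤ j → j ≤ m → g j ≡ g' j) →
  (∀ j → m < j → j ≤ n → g j ≡ n) →
  (∀ j → m < j → j ≤ n → g' j ≡ suc n) →
  ∀ y → swap (suc n) (suc m) (phiUpTo g n y) ≡ phiUpTo g' n y
phiUpTo-raiseTail {g} {g'} {m} m≤n g≗g' g-tail g'-tail y with t , refl ← m≤n⇒∃[o]m+o≡n m≤n = begin
  swap (suc (m + t)) (suc m) (phiUpTo g (m + t) y)
    ≡⟨ cong (swap _ (suc m)) (phiUpTo-constTail m t g-tail y) ⟩
  swap (suc (m + t)) (suc m) (segment (m + t) m t (phiUpTo g m y))
    ≡⟨ segment-cycle m t _ ⟩
  segment (suc (m + t)) m t (phiUpTo g m y)
    ≡⟨ cong (segment _ m t) (phiUpTo-cong m g≗g' y) ⟩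
  segment (suc (m + t)) m t (phiUpTo g' m y)
    ≡⟨ phiUpTo-constTail m t g'-tail y ⟨
  phiUpTo g' (m + t) y
    ∎

private
  variable
    ℓ ℓ′ ℓ″ : Level
    P : Pred ℕ ℓ
    Q : Pred ℕ ℓ′
    R : Pred ℕ ℓ″

indicator : ∀ {a} {A : Set a} → Dec A → ℕ
indicator a? = if does a? then 1 else 0

indicator-≤1 : ∀ {a} {A : Set a} (a? : Dec A) → indicator a? ≤ 1
indicator-≤1 (yes _) = ≤-refl
indicator-≤1 (no _)  = z≤n

count : Decidable P → ℕ → ℕ
count P? zero    = 0
count P? (suc m) = indicator (P? (suc m)) + count P? m

count-cong : (P? : Decidable P) (Q? : Decidable Q) → ∀ m →
             (∀ j → 1 ≤ j → j ≤ m → does (P? j) ≡ does (Q? j)) → count P? m ≡ count Q? m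
count-cong P? Q? zero    _  = refl
count-cong P? Q? (suc m) eq =
  cong₂ (λ b c → (if b then 1 else 0) + c) (eq (suc m) (s≤s z≤n) ≤-refl)
        (count-cong P? Q? m (λ j 1≤j j≤m → eq j 1≤j (m≤n⇒m≤1+n j≤m)))

count-≤ : (P? : Decidable P) → ∀ m → count P? m ≤ m
count-≤ P? zero    = z≤n
count-≤ P? (suc m) = +-mono-≤ (indicator-≤1 (P? (suc m))) (count-≤ P? m)

count-mono : (P? : Decidable P) → ∀ {m m′} → m ≤ m′ → count P? m ≤ count P? m′
count-mono P? {m′ = zero}  z≤n = ≤-refl
count-mono P? {m′ = suc m′} m≤1+m′ with m≤n⇒m<n∨m≡n m≤1+m′
... | inj₁ (s≤s m≤m′) = ≤-trans (count-mono P? m≤m′) (m≤n+m _ _)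
... | inj₂ refl       = ≤-refl

count-all : (P? : Decidable P) → ∀ m → (∀ j → 1 ≤ j → j ≤ m → P j) → count P? m ≡ m
count-all P? zero    _   = refl
count-all P? (suc m) all rewrite dec-true (P? (suc m)) (all (suc m) (s≤s z≤n) ≤-refl) =
  cong suc (count-all P? m (λ j 1≤j j≤m → all j 1≤j (m≤n⇒m≤1+n j≤m)))

count-stable : (P? : Decidable P) → ∀ {b m} → b ≤ m →
               (∀ j → b < j → j ≤ m → ¬ P j) → count P? m ≡ count P? b
count-stable P? {m = zero}  z≤n _ = refl
count-stable P? {b} {suc m} b≤1+m none with m≤n⇒m<n∨m≡n b≤1+m
... | inj₂ refl = refl
... | inj₁ (s≤s b≤m) rewrite dec-false (P? (suc m)) (none (suc m) (s≤s b≤m) ≤-refl) =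
  count-stable P? b≤m (λ j b<j j≤m → none j b<j (m≤n⇒m≤1+n j≤m))

count-complement : (P? : Decidable P) → ∀ m → count P? m + count (¬? ∘ P?) m ≡ m
count-complement P? zero = refl
count-complement P? (suc m) with P? (suc m)
... | yes _ = cong suc (count-complement P? m)
... | no _  = trans (+-suc (count P? m) _) (cong suc (count-complement P? m))

count-sum : (R? : Decidable R) (P? : Decidable P) (Q? : Decidable Q) → ∀ m →
            (∀ j → 1 ≤ j → j ≤ m → indicator (R? j) ≡ indicator (P? j) + indicator (Q? j)) →
            count R? m ≡ count P? m + count Q? m
count-sum R? P? Q? zero    _  = refl
count-sum R? P? Q? (suc m) eq = begin
  indicator (R? (suc m)) + count R? m
    ≡⟨ cong₂ _+_ (eq (suc m) (s≤s z≤n) ≤-refl)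
                 (count-sum R? P? Q? m (λ j 1≤j j≤m → eq j 1≤j (m≤n⇒m≤1+n j≤m))) ⟩
  (indicator (P? (suc m)) + indicator (Q? (suc m))) + (count P? m + count Q? m)
    ≡⟨ interchange (indicator (P? (suc m))) (indicator (Q? (suc m))) (count P? m) (count Q? m) ⟩
  (indicator (P? (suc m)) + count P? m) + (indicator (Q? (suc m)) + count Q? m)
    ∎

count-shift : (P? : Decidable P) → ∀ m → count P? (suc m) ≡ indicator (P? 1) + count (P? ∘ suc) m
count-shift P? zero    = refl
count-shift P? (suc m) =
  trans (cong (indicator (P? (suc (suc m))) +_) (count-shift P? m))
        (x∙yz≈y∙xz (indicator (P? (suc (suc m)))) (indicator (P? 1)) _)

count-reverse : (P? : Decidable P) → ∀ m → count P? m ≡ count (λ j → P? (suc m ∸ j)) m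
count-reverse P? zero    = refl
count-reverse P? (suc m) = begin
  count P? (suc m)
    ≡⟨ count-shift P? m ⟩
  indicator (P? 1) + count (P? ∘ suc) m
    ≡⟨ cong (indicator (P? 1) +_) (count-reverse (P? ∘ suc) m) ⟩
  indicator (P? 1) + count (λ j → P? (suc (suc m ∸ j))) m
    ≡⟨ cong₂ _+_ (cong (indicator ∘ P?) (m+n∸n≡m 1 m)) (count-cong _ _ m reindex) ⟨
  count (λ j → P? (suc (suc m) ∸ j)) (suc m)
    ∎
  where
  reindex : ∀ j → 1 ≤ j → j ≤ m → does (P? (suc (suc m) ∸ j)) ≡ does (P? (suc (suc m ∸ j)))
  reindex j _ j≤m = cong (does ∘ P?) (+-∸-assoc 1 (m≤n⇒m≤1+n j≤m))

DownClosed : ℕ → Pred ℕ ℓ → Set ℓ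
DownClosed m P = ∀ i j → 1 ≤ i → i ≤ j → j ≤ m → P j → P i

count-downClosed-≥ : (P? : Decidable P) → ∀ {m} → DownClosed m P →
                     ∀ {j} → 1 ≤ j → j ≤ m → P j → j ≤ count P? m
count-downClosed-≥ P? {m} closed {j} _ j≤m pj =
  subst (_≤ count P? m) (count-all P? j (λ i 1≤i i≤j → closed i j 1≤i i≤j j≤m pj)) (count-mono P? j≤m)

count-downClosed-< : (P? : Decidable P) → ∀ {m} → DownClosed m P →
                     ∀ {j} → 1 ≤ j → j ≤ m → ¬ P j → count P? m < j
count-downClosed-< {P = P} P? {m} closed {suc b} _ j≤m ¬pj =
  ≤-<-trans (≤-reflexive (count-stable P? (≤-trans (n≤1+n b) j≤m) none)) (s≤s (count-≤ P? b))
  where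
  none : ∀ k → b < k → k ≤ m → ¬ P k
  none k b<k k≤m pk = ¬pj (closed (suc b) k (s≤s z≤n) b<k k≤m pk)

Superexceedant : ℕ → (ℕ → ℕ) → Set
Superexceedant n h = ∀ j → 1 ≤ j → j ≤ n → (j ≤ h j) × (h j ≤ n)

lowerCode : ℕ → (ℕ → ℕ) → ℕ → ℕ
lowerCode n h i = suc (count (λ j → h j <? i) n)

m⊓n<o⇒m<o : ∀ {m n o} → o ≤ n → m ⊓ n < o → m < o
m⊓n<o⇒m<o {m} {n} {o} o≤n m⊓n<o with ≤-total m n
... | inj₁ m≤n = subst (_< o) (m≤n⇒m⊓n≡m m≤n) m⊓n<o
... | inj₂ n≤m = contradiction (subst (_< o) (m≥n⇒m⊓n≡n n≤m) m⊓n<o) (≤⇒≯ o≤n)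

truncate-superexceedant : ∀ {n h} → Superexceedant (suc n) h → Superexceedant n (λ j → h j ⊓ n)
truncate-superexceedant sup j 1≤j j≤n = ⊓-glb (proj₁ (sup j 1≤j (m≤n⇒m≤1+n j≤n))) j≤n , m⊓n≤n _ _

truncate-nonDecreasing : ∀ {n h} → NonDecreasing (suc n) h → NonDecreasing n (λ j → h j ⊓ n)
truncate-nonDecreasing {n} mono i j 1≤i i≤j j≤n = ⊓-monoˡ-≤ n (mono i j 1≤i i≤j (m≤n⇒m≤1+n j≤n))

lowerCode-truncate : ∀ {n h} → Superexceedant (suc n) h →
                     ∀ i → 1 ≤ i → i ≤ n → lowerCode (suc n) h i ≡ lowerCode n (λ j → h j ⊓ n) i
lowerCode-truncate {n} {h} sup i _ i≤n
  rewrite dec-false (h (suc n) <? i)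
                    (≤⇒≯ (≤-trans (m≤n⇒m≤1+n i≤n) (proj₁ (sup (suc n) (s≤s z≤n) ≤-refl)))) =
  cong suc (count-cong _ _ n λ j _ _ →
    does-⇔ (mk⇔ (≤-<-trans (m⊓n≤m (h j) n)) (m⊓n<o⇒m<o i≤n)) (h j <? i) (h j ⊓ n <? i))

phiUpTo-lowerCode : ∀ n h → Superexceedant n h → NonDecreasing n h →
                    ∀ y → phiUpTo (lowerCode n h) n y ≡ phiUpTo h n y
phiUpTo-lowerCode zero    _ _   _    _ = refl
phiUpTo-lowerCode (suc n) h sup mono y = begin
  swap N (suc m) (phiUpTo (lowerCode N h) n y)
    ≡⟨ cong (swap N (suc m)) (phiUpTo-cong n (lowerCode-truncate sup) y) ⟩
  swap N (suc m) (phiUpTo (lowerCode n h′) n y)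
    ≡⟨ cong (swap N (suc m)) (phiUpTo-lowerCode n h′ sup′ mono′ y) ⟩
  swap N (suc m) (phiUpTo h′ n y)
    ≡⟨ phiUpTo-raiseTail m≤n head tail′ (λ j m<j j≤n → tail j m<j (m≤n⇒m≤1+n j≤n)) y ⟩
  phiUpTo h n y
    ≡⟨ swap-diag N _ ⟨
  swap N N (phiUpTo h n y)
    ≡⟨ cong (λ c → swap N c (phiUpTo h n y)) hN ⟨
  swap N (h N) (phiUpTo h n y)
    ∎
  where
  N = suc n
  h′ : ℕ → ℕ
  h′ j = h j ⊓ n
  sup′ = truncate-superexceedant sup
  mono′ = truncate-nonDecreasing mono
  below? : Decidable (λ j → h j < N)
  below? j = h j <? N
  m = count below? N
  hN : h N ≡ N
  hN = ≤-antisym (proj₂ (sup N (s≤s z≤n) ≤-refl)) (proj₁ (sup N (s≤s z≤n) ≤-refl))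
  closed : DownClosed N (λ j → h j < N)
  closed i j 1≤i i≤j j≤N = ≤-<-trans (mono i j 1≤i i≤j j≤N)
  m≤n : m ≤ n
  m≤n = ≤-pred (count-downClosed-< below? closed (s≤s z≤n) ≤-refl (<-irrefl hN))
  head : ∀ j → 1 ≤ j → j ≤ m → h′ j ≡ h j
  head j 1≤j j≤m with below? j
  ... | yes hj<N = m≤n⇒m⊓n≡m (≤-pred hj<N)
  ... | no hj≮N  =
    contradiction j≤m (<⇒≱ (count-downClosed-< below? closed 1≤j (≤-trans j≤m (m≤n⇒m≤1+n m≤n)) hj≮N))
  tail : ∀ j → m < j → j ≤ N → h j ≡ N
  tail j m<j j≤N = ≤-antisym (proj₂ (sup j 1≤j j≤N))
                             (≮⇒≥ λ hj<N → <⇒≱ m<j (count-downClosed-≥ below? closed 1≤j j≤N hj<N))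
    where
    1≤j = ≤-trans (s≤s z≤n) m<j
  tail′ : ∀ j → m < j → j ≤ n → h′ j ≡ n
  tail′ j m<j j≤n = m≥n⇒m⊓n≡n (subst (n ≤_) (sym (tail j m<j (m≤n⇒m≤1+n j≤n))) (n≤1+n n))

-- ω x = n + 1 − x on [0, n + 1], extended by the identity so that it is an involution of ℕ
reflect : ℕ → ℕ → ℕ
reflect n x = if does (x ≤? suc n) then suc n ∸ x else x

reflect-≤ : ∀ {n x} → x ≤ suc n → reflect n x ≡ suc n ∸ x
reflect-≤ {n} {x} x≤1+n rewrite dec-true (x ≤? suc n) x≤1+n = refl

reflect-> : ∀ {n x} → ¬ x ≤ suc n → reflect n x ≡ x
reflect-> {n} {x} x≰1+n rewrite dec-false (x ≤? suc n) x≰1+n = refl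

reflect-involutive : ∀ n x → reflect n (reflect n x) ≡ x
reflect-involutive n x with x ≤? suc n
... | yes x≤1+n = begin
  reflect n (reflect n x)    ≡⟨ cong (reflect n) (reflect-≤ x≤1+n) ⟩
  reflect n (suc n ∸ x)      ≡⟨ reflect-≤ (m∸n≤m (suc n) x) ⟩
  suc n ∸ (suc n ∸ x)        ≡⟨ m∸[m∸n]≡n x≤1+n ⟩
  x                          ∎
... | no x≰1+n = trans (cong (reflect n) (reflect-> x≰1+n)) (reflect-> x≰1+n)

reflect-injective : ∀ n → Injective _≡_ _≡_ (reflect n)
reflect-injective n {x} {y} eq = begin
  x                          ≡⟨ reflect-involutive n x ⟨
  reflect n (reflect n x)    ≡⟨ cong (reflect n) eq ⟩
  reflect n (reflect n y)    ≡⟨ reflect-involutive n y ⟩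
  y                          ∎

reflect-opposite : ∀ {n} (x : Fin n) → reflect n (suc (toℕ x)) ≡ suc (toℕ (opposite x))
reflect-opposite {n} x = begin
  reflect n (suc (toℕ x))    ≡⟨ reflect-≤ (m≤n⇒m≤1+n (toℕ<n x)) ⟩
  n ∸ toℕ x                  ≡⟨ +-∸-assoc 1 (toℕ<n x) ⟩
  suc (n ∸ suc (toℕ x))      ≡⟨ cong suc (opposite-prop x) ⟨
  suc (toℕ (opposite x))     ∎

reflectCode : ℕ → (ℕ → ℕ) → ℕ → ℕ
reflectCode n f j = reflect n (f (reflect n j))

phiDownFrom : (ℕ → ℕ) → ℕ → ℕ → ℕ → ℕ
phiDownFrom f t zero    x = x
phiDownFrom f t (suc m) x = swap (t ∸ m) (f (t ∸ m)) (phiDownFrom f t m x)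

phiDownFrom-phiUpTo : ∀ f {t m} → m ≤ t →
                      ∀ y → phiDownFrom f t m (phiUpTo f t y) ≡ phiUpTo f (t ∸ m) y
phiDownFrom-phiUpTo f {m = zero}  _   y = refl
phiDownFrom-phiUpTo f {t} {suc m} m<t y = begin
  swap (t ∸ m) (f (t ∸ m)) (phiDownFrom f t m (phiUpTo f t y))
    ≡⟨ cong (swap _ _) (phiDownFrom-phiUpTo f (<⇒≤ m<t) y) ⟩
  swap (t ∸ m) (f (t ∸ m)) (phiUpTo f (t ∸ m) y)
    ≡⟨ cong (λ k → swap k (f k) (phiUpTo f k y)) (+-∸-assoc 1 m<t) ⟩
  swap (suc k) (f (suc k)) (phiUpTo f (suc k) y)
    ≡⟨ swap-involutive _ _ _ ⟩
  phiUpTo f k y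
    ∎
  where
  k = t ∸ suc m

phiUpTo-reflectCode : ∀ {n} f {m} → m ≤ n →
                      ∀ w → phiUpTo (reflectCode n f) m w ≡ reflect n (phiDownFrom f n m (reflect n w))
phiUpTo-reflectCode {n} f {zero}  _   w = sym (reflect-involutive n w)
phiUpTo-reflectCode {n} f {suc m} m<n w = begin
  swap (suc m) (reflect n (f (reflect n (suc m)))) (phiUpTo (reflectCode n f) m w)
    ≡⟨ cong₂ (λ k z → swap (suc m) (reflect n (f k)) z) ω[1+m]≡k (phiUpTo-reflectCode f (<⇒≤ m<n) w) ⟩
  swap (suc m) (reflect n (f k)) (reflect n z)
    ≡⟨ cong (λ a → swap a (reflect n (f k)) (reflect n z)) ωk≡1+m ⟨
  swap (reflect n k) (reflect n (f k)) (reflect n z)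
    ≡⟨ swap-conjugate (reflect n) (reflect-injective n) k (f k) z ⟨
  reflect n (swap k (f k) z)
    ∎
  where
  k = n ∸ m
  z = phiDownFrom f n m (reflect n w)
  ω[1+m]≡k : reflect n (suc m) ≡ k
  ω[1+m]≡k = reflect-≤ (m≤n⇒m≤1+n m<n)
  ωk≡1+m : reflect n k ≡ suc m
  ωk≡1+m = trans (cong (reflect n) (sym ω[1+m]≡k)) (reflect-involutive n (suc m))

m≤o∸n⇒n≤o∸m : ∀ {m n o} → n ≤ o → m ≤ o ∸ n → n ≤ o ∸ m
m≤o∸n⇒n≤o∸m {m} {n} {o} n≤o m≤o∸n = subst (_≤ o ∸ m) (m∸[m∸n]≡n n≤o) (∸-monoʳ-≤ o m≤o∸n)

m≰o∸n⇔o∸m<n : ∀ {m n o} → m ≤ o → n ≤ o → (¬ m ≤ o ∸ n) ⇔ (o ∸ m < n)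
m≰o∸n⇔o∸m<n m≤o n≤o =
  mk⇔ (λ m≰o∸n → ≰⇒> (m≰o∸n ∘ m≤o∸n⇒n≤o∸m m≤o))
      (λ o∸m<n m≤o∸n → <⇒≱ o∸m<n (m≤o∸n⇒n≤o∸m n≤o m≤o∸n))

1+n∸j-inRange : ∀ {n j} → 1 ≤ j → j ≤ n → 1 ≤ suc n ∸ j × suc n ∸ j ≤ n
1+n∸j-inRange {n} 1≤j j≤n = m<n⇒0<n∸m (s≤s j≤n) , ∸-monoʳ-≤ (suc n) 1≤j

reflectCode-≡ : ∀ {n f} → Subexceedant n f → ∀ {j} → 1 ≤ j → j ≤ n →
                reflectCode n f j ≡ suc n ∸ f (suc n ∸ j)
reflectCode-≡ {n} {f} sub {j} 1≤j j≤n
  rewrite reflect-≤ (m≤n⇒m≤1+n j≤n) =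
  reflect-≤ (≤-trans (proj₂ (sub k 1≤k k≤n)) (m≤n⇒m≤1+n k≤n))
  where
  k = suc n ∸ j
  1≤k = proj₁ (1+n∸j-inRange 1≤j j≤n)
  k≤n = proj₂ (1+n∸j-inRange 1≤j j≤n)

reflectCode-superexceedant : ∀ {n f} → Subexceedant n f → Superexceedant n (reflectCode n f)
reflectCode-superexceedant {n} {f} sub j 1≤j j≤n rewrite reflectCode-≡ sub 1≤j j≤n =
  m≤o∸n⇒n≤o∸m (m≤n⇒m≤1+n j≤n) (proj₂ (sub k 1≤k k≤n)) , ∸-monoʳ-≤ (suc n) (proj₁ (sub k 1≤k k≤n))
  where
  k = suc n ∸ j
  1≤k = proj₁ (1+n∸j-inRange 1≤j j≤n)
  k≤n = proj₂ (1+n∸j-inRange 1≤j j≤n)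

reflectCode-nonDecreasing : ∀ {n f} → Subexceedant n f → NonDecreasing n f →
                            NonDecreasing n (reflectCode n f)
reflectCode-nonDecreasing {n} {f} sub mono i j 1≤i i≤j j≤n
  rewrite reflectCode-≡ sub 1≤i (≤-trans i≤j j≤n) | reflectCode-≡ sub (≤-trans 1≤i i≤j) j≤n =
  ∸-monoʳ-≤ (suc n) (mono (suc n ∸ j) (suc n ∸ i)
    (proj₁ (1+n∸j-inRange 1≤j j≤n)) (∸-monoʳ-≤ (suc n) i≤j) (proj₂ (1+n∸j-inRange 1≤i i≤n)))
  where
  1≤j = ≤-trans 1≤i i≤j
  i≤n = ≤-trans i≤j j≤n

countUpTo≡count : ∀ f k m → countUpTo f k m ≡ count (λ j → f j ≟ k) m
countUpTo≡count f k zero    = refl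
countUpTo≡count f k (suc m) = cong (indicator (f (suc m) ≟ k) +_) (countUpTo≡count f k m)

indicator-≤1+ : ∀ x t → indicator (x ≤? suc t) ≡ indicator (x ≟ suc t) + indicator (x ≤? t)
indicator-≤1+ x t with x ≤? t | x ≟ suc t
... | yes x≤t | _
  rewrite dec-true (x ≤? suc t) (m≤n⇒m≤1+n x≤t)
        | dec-false (x ≟ suc t) (<⇒≢ (s≤s x≤t)) | dec-true (x ≤? t) x≤t = refl
... | no _ | yes refl
  rewrite dec-true (suc t ≤? suc t) ≤-refl
        | dec-true (suc t ≟ suc t) refl | dec-false (suc t ≤? t) 1+n≰n = refl
... | no x≰t | no x≢1+t
  rewrite dec-false (x ≤? suc t) ([ x≰t ∘ ≤-pred , x≢1+t ]′ ∘ m≤n⇒m<n∨m≡n)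
        | dec-false (x ≟ suc t) x≢1+t | dec-false (x ≤? t) x≰t = refl

sumR≡count : ∀ {n f} → Subexceedant n f → ∀ t → sumR n f t ≡ count (λ j → f j ≤? t) n
sumR≡count {n} {f} sub zero =
  sym (count-stable (λ j → f j ≤? 0) z≤n λ j 1≤j j≤n → <⇒≱ (proj₁ (sub j 1≤j j≤n)))
sumR≡count {n} {f} sub (suc t) = begin
  countUpTo f (suc t) n + sumR n f t
    ≡⟨ cong₂ _+_ (countUpTo≡count f (suc t) n) (sumR≡count sub t) ⟩
  count (λ j → f j ≟ suc t) n + count (λ j → f j ≤? t) n
    ≡⟨ count-sum _ _ _ n (λ j _ _ → indicator-≤1+ (f j) t) ⟨
  count (λ j → f j ≤? suc t) n
    ∎

count-complement-∸ : (P? : Decidable P) → ∀ m → m ∸ count P? m ≡ count (¬? ∘ P?) m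
count-complement-∸ P? m =
  trans (cong (_∸ count P? m) (sym (count-complement P? m))) (m+n∸m≡n (count P? m) _)

Flip≡lowerCode : ∀ {n f} → Subexceedant n f →
                 ∀ i → 1 ≤ i → i ≤ n → Flip n f i ≡ lowerCode n (reflectCode n f) i
Flip≡lowerCode {n} {f} sub i _ i≤n = begin
  (n + 1) ∸ sumR n f ((n ∸ i) + 1)                  ≡⟨ cong₂ _∸_ (+-comm n 1) (cong (sumR n f) t≡) ⟩
  suc n ∸ sumR n f t                                ≡⟨ cong (suc n ∸_) (sumR≡count sub t) ⟩
  suc n ∸ count atMost? n                           ≡⟨ +-∸-assoc 1 (count-≤ atMost? n) ⟩
  suc (n ∸ count atMost? n)                         ≡⟨ cong suc (count-complement-∸ atMost? n) ⟩
  suc (count (¬? ∘ atMost?) n)                      ≡⟨ cong suc (count-reverse (¬? ∘ atMost?) n) ⟩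
  suc (count (λ j → ¬? (atMost? (suc n ∸ j))) n)    ≡⟨ cong suc (count-cong _ _ n reflected) ⟩
  suc (count (λ j → reflectCode n f j <? i) n)      ∎
  where
  t = suc n ∸ i
  t≡ : (n ∸ i) + 1 ≡ t
  t≡ = trans (+-comm (n ∸ i) 1) (sym (+-∸-assoc 1 i≤n))
  atMost? : Decidable (λ j → f j ≤ t)
  atMost? j = f j ≤? t
  reflected : ∀ j → 1 ≤ j → j ≤ n → does (¬? (atMost? (suc n ∸ j))) ≡ does (reflectCode n f j <? i)
  reflected j 1≤j j≤n rewrite reflectCode-≡ sub 1≤j j≤n =
    does-⇔ (m≰o∸n⇔o∸m<n fk≤1+n (m≤n⇒m≤1+n i≤n)) (¬? (atMost? k)) (suc n ∸ f k <? i)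
    where
    k = suc n ∸ j
    fk≤1+n : f k ≤ suc n
    k-inRange = 1+n∸j-inRange 1≤j j≤n
    fk≤1+n = ≤-trans (proj₂ (sub k (proj₁ k-inRange) (proj₂ k-inRange))) (m∸n≤m (suc n) j)

phi-Flip-reflect : ∀ n f → InFnUp n f → ∀ y → phi n (Flip n f) (reflect n (phi n f y)) ≡ reflect n y
phi-Flip-reflect n f (sub , mono) y = begin
  phiUpTo (Flip n f) n (reflect n z)
    ≡⟨ phiUpTo-cong n (Flip≡lowerCode sub) _ ⟩
  phiUpTo (lowerCode n h) n (reflect n z)
    ≡⟨ phiUpTo-lowerCode n h (reflectCode-superexceedant sub) (reflectCode-nonDecreasing sub mono) _ ⟩
  phiUpTo h n (reflect n z)
    ≡⟨ phiUpTo-reflectCode {n} f ≤-refl _ ⟩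
  reflect n (phiDownFrom f n n (reflect n (reflect n z)))
    ≡⟨ cong (reflect n ∘ phiDownFrom f n n) (reflect-involutive n z) ⟩
  reflect n (phiDownFrom f n n z)
    ≡⟨ cong (reflect n) (phiDownFrom-phiUpTo f {n} ≤-refl y) ⟩
  reflect n (phiUpTo f (n ∸ n) y)
    ≡⟨ cong (λ k → reflect n (phiUpTo f k y)) (n∸n≡0 n) ⟩
  reflect n y
    ∎
  where
  h = reflectCode n f
  z = phiUpTo f n y

theorem5p2 : (n : ℕ) (f : ℕ → ℕ) (σ : Permutation′ n) →
    InFnUp n f →
    RepresentedBy (phi n f) (σ ⟨$⟩ʳ_) →
    RepresentedBy (phi n (Flip n f)) (tau σ)
theorem5p2 n f σ f↗ φf≡σ x = begin
  phi n (Flip n f) (suc (toℕ x))                        ≡⟨ cong (phi n (Flip n f)) x≡ω[φf[1+z]] ⟩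
  phi n (Flip n f) (reflect n (phi n f (suc (toℕ z))))  ≡⟨ phi-Flip-reflect n f f↗ _ ⟩
  reflect n (suc (toℕ z))                               ≡⟨ reflect-opposite z ⟩
  suc (toℕ (opposite z))                                ∎
  where
  z = σ ⟨$⟩ˡ opposite x
  x≡ω[φf[1+z]] : suc (toℕ x) ≡ reflect n (phi n f (suc (toℕ z)))
  x≡ω[φf[1+z]] = begin
    suc (toℕ x)                                  ≡⟨ cong (suc ∘ toℕ) (opposite-involutive x) ⟨
    suc (toℕ (opposite (opposite x)))            ≡⟨ reflect-opposite (opposite x) ⟨
    reflect n (suc (toℕ (opposite x)))           ≡⟨ cong (reflect n ∘ suc ∘ toℕ) (inverseʳ σ) ⟨
    reflect n (suc (toℕ (σ ⟨$⟩ʳ z)))             ≡⟨ cong (reflect n) (φf≡σ z) ⟨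
    reflect n (phi n f (suc (toℕ z)))            ∎
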